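{- Let $\Sigma$ be a finite alphabet, $\vartheta$ a commutation relation on $\Sigma$, $B\subseteq\Sigma$, and let $L\subseteq\mathbf{M}(\Sigma,\vartheta)$ be the set of traces whose terminal alphabet is contained in $\Sigma\setminus B$. Let $\mathcal{A}_B$ be the automaton over $\Sigma$ whose set of states is the set of all subsets of $B$, whose unique initial state and unique final state are both $\emptyset$, and whose transitions are $(B',x,(B'\cup\{x\})\cap\mathrm{Com}(x)\cap B)$ for all $B'\subseteq B$ and $x\in\Sigma$. Then $\mathcal{A}_B$ is a complete deterministic automaton recognizing $\mathrm{Rep}(L)$.
   Context: A commutation relation $\vartheta$ on $\Sigma$ is a reflexive and symmetric relation. The trace monoid $\mathbf{M}(\Sigma,\vartheta)=\Sigma^*/\equiv_\vartheta$, where $\equiv_\vartheta$ is the congruence generated by $ab\equiv ba$ for $(a,b)\in\vartheta$. Let $\phi:\Sigma^*\to\mathbf{M}(\Sigma,\vartheta)$ be the natural surjection; for a set $S$ of traces, $\mathrm{Rep}(S)=\phi^{ -1}(S)$. For $x\in\Sigma$, $\mathrm{Com}(x)=\{z\in\Sigma:(x,z)\in\vartheta\}$ (so $x\in\mathrm{Com}(x)$). The terminal alphabet of a trace $w$ is $TA(w)=\{x\in\Sigma : w=ux \text{ for some } u\in\mathbf{M}(\Sigma,\vartheta)\}$. -}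

module Defs where

open import Data.Nat using (ℕ)
open import Data.Fin using (Fin)
open import Data.Bool using (Bool; true)
open import Data.List using (List; []; _∷_; _++_; [_])
open import Data.Vec using (tabulate)
open import Data.Product using (Σ; ∃; _×_)
open import Data.Fin.Subset using (Subset; ⁅_⁆; _∈_; _∉_; _⊆_; _∩_; _∪_; ⊥)
open import Relation.Binary.PropositionalEquality using (_≡_)

record CommRel (n : ℕ) : Set where
  field
    θ     : Fin n → Fin n → Bool
    θ-refl : ∀ x → θ x x ≡ true
    θ-sym  : ∀ x y → θ x y ≡ θ y x
open CommRel public

Word : ℕ → Set
Word n = List (Fin n)

-- ≡_θ : the congruence on Σ* generated by ab ≡ ba for (a,b) ∈ θ.
-- (Equivalence closure of the one-step swap relation, which is
-- already compatible with concatenation.)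
data _≈[_]_ {n : ℕ} : Word n → CommRel n → Word n → Set where
  ≈-refl  : ∀ {ϑ u} → u ≈[ ϑ ] u
  ≈-sym   : ∀ {ϑ u v} → u ≈[ ϑ ] v → v ≈[ ϑ ] u
  ≈-trans : ∀ {ϑ u v w} → u ≈[ ϑ ] v → v ≈[ ϑ ] w → u ≈[ ϑ ] w
  ≈-swap  : ∀ {ϑ} u v a b → θ ϑ a b ≡ true →
            (u ++ a ∷ b ∷ v) ≈[ ϑ ] (u ++ b ∷ a ∷ v)

-- Traces are ≡_θ-classes of words; a trace is represented by any word.
-- x ∈ TA([w])  iff  [w] = [u] x for some trace [u], i.e. w ≡_θ u x.
InTA : ∀ {n} → CommRel n → Fin n → Word n → Set
InTA {n} ϑ x w = ∃ λ (u : Word n) → w ≈[ ϑ ] (u ++ [ x ])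

-- L = { traces t : TA(t) ⊆ Σ ∖ B };  Rep(L) = φ⁻¹(L).
InRepL : ∀ {n} → CommRel n → Subset n → Word n → Set
InRepL ϑ B w = ∀ x → InTA ϑ x w → x ∉ B

Com : ∀ {n} → CommRel n → Fin n → Subset n
Com ϑ x = tabulate (λ z → θ ϑ x z)

record Automaton (n : ℕ) : Set₁ where
  field
    IsState : Subset n → Set
    Initial : Subset n → Set
    Final   : Subset n → Set
    Trans   : Subset n → Fin n → Subset n → Set
open Automaton public

data Run {n : ℕ} (A : Automaton n) : Subset n → Word n → Subset n → Set where
  run-nil  : ∀ {p} → Run A p [] p
  run-cons : ∀ {p x q w r} → Trans A p x q → IsState A q →
             Run A q w r → Run A p (x ∷ w) r

Accepts : ∀ {n} → Automaton n → Word n → Set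
Accepts A w = ∃ λ i → ∃ λ f →
  IsState A i × Initial A i × IsState A f × Final A f × Run A i w f

IsCompleteDeterministic : ∀ {n} → Automaton n → Set
IsCompleteDeterministic {n} A =
  (∃ λ i → IsState A i × Initial A i) ×
  (∀ i j → IsState A i → Initial A i → IsState A j → Initial A j → i ≡ j) ×
  (∀ p (x : Fin n) → IsState A p → ∃ λ q → IsState A q × Trans A p x q) ×
  (∀ p (x : Fin n) q q' → IsState A p → IsState A q → IsState A q' →
     Trans A p x q → Trans A p x q' → q ≡ q')

Recognizes : ∀ {n} → Automaton n → (Word n → Set) → Set
Recognizes A P = ∀ w → (Accepts A w → P w) × (P w → Accepts A w)

A[_,_] : ∀ {n} → CommRel n → Subset n → Automaton n
A[ ϑ , B ] = record
  { IsState = λ S → S ⊆ B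
  ; Initial = λ S → S ≡ ⊥
  ; Final   = λ S → S ≡ ⊥
  ; Trans   = λ p x q → q ≡ ((p ∪ ⁅ x ⁆) ∩ Com ϑ x) ∩ B
  }

-- The state reached from ∅ on a word w is the set of letters x ∈ B that occur in w
-- with every later letter commuting with x, i.e. the letters of B that can be moved
-- to the end of w: the terminal alphabet of [w] intersected with B.  The transition
-- map commutes along commuting letters, so the state depends only on the trace [w];
-- and w is accepted iff TA([w]) ∩ B = ∅.
module Submission where

open import Defs
open import Data.Nat using (ℕ)
open import Data.Bool using (true)
open import Data.Product using (_×_; _,_)
open import Data.Sum using (_⊎_; inj₁; inj₂; [_,_])
open import Data.Fin using (Fin)
open import Data.Fin.Subset using (Subset; ⁅_⁆; _∪_; _∩_; ⊥; _⊆_; _∈_)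
open import Data.Fin.Subset.Properties
  using (x∈p∩q⁺; x∈p∩q⁻; x∈p∪q⁺; x∈p∪q⁻; x∈⁅x⁆; x∈⁅y⁆⇒x≡y; p∩q⊆q; ⊆-antisym; ⊆-min; ∉⊥; Empty-unique)
open import Data.Vec.Properties using (lookup∘tabulate; []=⇒lookup; lookup⇒[]=)
open import Data.List using ([]; _∷_; _++_; _∷ʳ_; foldl) renaming ([_] to [_]ˡ)
open import Data.List.Properties using (++-assoc; foldl-++)
open import Data.List.Reverse using (Reverse; []; _∶_∶ʳ_; reverseView)
open import Relation.Binary.PropositionalEquality using (_≡_; refl; sym; trans; cong; subst; subst₂)

module Traces {n : ℕ} (ϑ : CommRel n) where

  ≈-++ʳ : ∀ {u v} w → u ≈[ ϑ ] v → (u ++ w) ≈[ ϑ ] (v ++ w)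
  ≈-++ʳ w ≈-refl = ≈-refl
  ≈-++ʳ w (≈-sym e) = ≈-sym (≈-++ʳ w e)
  ≈-++ʳ w (≈-trans e e′) = ≈-trans (≈-++ʳ w e) (≈-++ʳ w e′)
  ≈-++ʳ w (≈-swap u v a b t) =
    subst₂ (_≈[ ϑ ]_) (sym (++-assoc u (a ∷ b ∷ v) w)) (sym (++-assoc u (b ∷ a ∷ v) w))
      (≈-swap u (v ++ w) a b t)

  ∷ʳ-swap : ∀ u {a b} → θ ϑ a b ≡ true → ((u ∷ʳ a) ∷ʳ b) ≈[ ϑ ] ((u ∷ʳ b) ∷ʳ a)
  ∷ʳ-swap u {a} {b} t =
    subst₂ (_≈[ ϑ ]_) (sym (++-assoc u [ a ]ˡ [ b ]ˡ)) (sym (++-assoc u [ b ]ˡ [ a ]ˡ))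
      (≈-swap u _ a b t)

  InTA-∷ʳ : ∀ {x z w} → θ ϑ z x ≡ true → InTA ϑ z w → InTA ϑ z (w ∷ʳ x)
  InTA-∷ʳ {x} t (u , w≈uz) = u ∷ʳ x , ≈-trans (≈-++ʳ [ x ]ˡ w≈uz) (∷ʳ-swap u t)

  ∈Com⁺ : ∀ {x z} → θ ϑ x z ≡ true → z ∈ Com ϑ x
  ∈Com⁺ {x} {z} t = lookup⇒[]= z (Com ϑ x) (trans (lookup∘tabulate (θ ϑ x) z) t)

  ∈Com⁻ : ∀ {x z} → z ∈ Com ϑ x → θ ϑ x z ≡ true
  ∈Com⁻ {x} {z} z∈ = trans (sym (lookup∘tabulate (θ ϑ x) z)) ([]=⇒lookup z∈)

  Com-sym : ∀ {x z} → z ∈ Com ϑ x → x ∈ Com ϑ z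
  Com-sym {x} {z} z∈ = ∈Com⁺ (trans (θ-sym ϑ z x) (∈Com⁻ z∈))

  x∈Com-x : ∀ x → x ∈ Com ϑ x
  x∈Com-x x = ∈Com⁺ (θ-refl ϑ x)

module Transitions {n : ℕ} (ϑ : CommRel n) (B : Subset n) where

  open Traces ϑ

  step : Subset n → Fin n → Subset n
  step p x = ((p ∪ ⁅ x ⁆) ∩ Com ϑ x) ∩ B

  δ : Subset n → Word n → Subset n
  δ = foldl step

  ∈-step⁺ : ∀ {p x z} → z ∈ p ⊎ z ≡ x → z ∈ Com ϑ x → z ∈ B → z ∈ step p x
  ∈-step⁺ (inj₁ z∈p) z∈C z∈B = x∈p∩q⁺ (x∈p∩q⁺ (x∈p∪q⁺ (inj₁ z∈p) , z∈C) , z∈B)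
  ∈-step⁺ (inj₂ refl) z∈C z∈B = x∈p∩q⁺ (x∈p∩q⁺ (x∈p∪q⁺ (inj₂ (x∈⁅x⁆ _)) , z∈C) , z∈B)

  ∈-step⁻ : ∀ {p x z} → z ∈ step p x → (z ∈ p ⊎ z ≡ x) × z ∈ Com ϑ x × z ∈ B
  ∈-step⁻ {p} {x} z∈ with x∈p∩q⁻ _ B z∈
  ... | z∈′ , z∈B with x∈p∩q⁻ (p ∪ ⁅ x ⁆) _ z∈′
  ... | z∈p∪x , z∈C with x∈p∪q⁻ p ⁅ x ⁆ z∈p∪x
  ... | inj₁ z∈p = inj₁ z∈p , z∈C , z∈B
  ... | inj₂ z∈x = inj₂ (x∈⁅y⁆⇒x≡y x z∈x) , z∈C , z∈B

  step-⊆ : ∀ p x → step p x ⊆ B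
  step-⊆ p x = p∩q⊆q _ B

  δ-⊆ : ∀ {p} w → p ⊆ B → δ p w ⊆ B
  δ-⊆ [] p⊆B = p⊆B
  δ-⊆ {p} (x ∷ w) _ = δ-⊆ w (step-⊆ p x)

  step-comm-⊆ : ∀ q {a b} → θ ϑ a b ≡ true → step (step q a) b ⊆ step (step q b) a
  step-comm-⊆ q t z∈ with ∈-step⁻ z∈
  ... | inj₂ refl , z∈Cb , z∈B = ∈-step⁺ (inj₁ (∈-step⁺ (inj₂ refl) z∈Cb z∈B)) (∈Com⁺ t) z∈B
  ... | inj₁ z∈qa , z∈Cb , z∈B with ∈-step⁻ z∈qa
  ...   | inj₁ z∈q , z∈Ca , _ = ∈-step⁺ (inj₁ (∈-step⁺ (inj₁ z∈q) z∈Cb z∈B)) z∈Ca z∈B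
  ...   | inj₂ refl , z∈Ca , _ = ∈-step⁺ (inj₂ refl) z∈Ca z∈B

  step-comm : ∀ q {a b} → θ ϑ a b ≡ true → step (step q a) b ≡ step (step q b) a
  step-comm q {a} {b} t = ⊆-antisym (step-comm-⊆ q t) (step-comm-⊆ q (trans (θ-sym ϑ b a) t))

  δ-resp-≈ : ∀ p {u v} → u ≈[ ϑ ] v → δ p u ≡ δ p v
  δ-resp-≈ p ≈-refl = refl
  δ-resp-≈ p (≈-sym e) = sym (δ-resp-≈ p e)
  δ-resp-≈ p (≈-trans e e′) = trans (δ-resp-≈ p e) (δ-resp-≈ p e′)
  δ-resp-≈ p (≈-swap u v a b t) = begin
    δ p (u ++ a ∷ b ∷ v)       ≡⟨ foldl-++ step p u (a ∷ b ∷ v) ⟩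
    δ (step (step q a) b) v    ≡⟨ cong (λ r → δ r v) (step-comm q t) ⟩
    δ (step (step q b) a) v    ≡⟨ foldl-++ step p u (b ∷ a ∷ v) ⟨
    δ p (u ++ b ∷ a ∷ v)       ∎
    where
    open Relation.Binary.PropositionalEquality.≡-Reasoning
    q = δ p u

  δ-∷ʳ : ∀ p u x → δ p (u ∷ʳ x) ≡ step (δ p u) x
  δ-∷ʳ p u x = foldl-++ step p u [ x ]ˡ

  x∈δ-∷ʳ : ∀ p u {x} → x ∈ B → x ∈ δ p (u ∷ʳ x)
  x∈δ-∷ʳ p u {x} x∈B =
    subst (x ∈_) (sym (δ-∷ʳ p u x)) (∈-step⁺ (inj₂ refl) (x∈Com-x x) x∈B)

  ∈-δ⁻ : ∀ {p z w} → Reverse w → z ∈ δ p w → z ∈ p ⊎ InTA ϑ z w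
  ∈-δ⁻ [] z∈p = inj₁ z∈p
  ∈-δ⁻ {p} {z} (u ∶ ru ∶ʳ x) z∈ with ∈-step⁻ (subst (z ∈_) (δ-∷ʳ p u x) z∈)
  ... | inj₂ refl , _ , _ = inj₂ (u , ≈-refl)
  ... | inj₁ z∈δu , z∈Cx , _ with ∈-δ⁻ ru z∈δu
  ...   | inj₁ z∈p = inj₁ z∈p
  ...   | inj₂ z∈TA = inj₂ (InTA-∷ʳ (∈Com⁻ (Com-sym z∈Cx)) z∈TA)

  δ≡⊥⇒InRepL : ∀ {w} → δ ⊥ w ≡ ⊥ → InRepL ϑ B w
  δ≡⊥⇒InRepL δw≡⊥ x (u , w≈ux) x∈B =
    ∉⊥ (subst (x ∈_) (trans (δ-resp-≈ ⊥ (≈-sym w≈ux)) δw≡⊥) (x∈δ-∷ʳ ⊥ u x∈B))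

  InRepL⇒δ≡⊥ : ∀ {w} → InRepL ϑ B w → δ ⊥ w ≡ ⊥
  InRepL⇒δ≡⊥ {w} w∈L = Empty-unique λ (z , z∈) →
    [ ∉⊥ , (λ z∈TA → w∈L z z∈TA (δ-⊆ w (⊆-min B) z∈)) ] (∈-δ⁻ (reverseView w) z∈)

module Automaton-A {n : ℕ} (ϑ : CommRel n) (B : Subset n) where

  open Transitions ϑ B

  A : Automaton n
  A = A[ ϑ , B ]

  run⇒≡δ : ∀ {p w r} → Run A p w r → r ≡ δ p w
  run⇒≡δ run-nil = refl
  run⇒≡δ (run-cons refl _ run) = run⇒≡δ run

  run-δ : ∀ {p} w → p ⊆ B → Run A p w (δ p w)
  run-δ [] _ = run-nil
  run-δ {p} (x ∷ w) _ = run-cons refl (step-⊆ p x) (run-δ w (step-⊆ p x))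

  accepts⇒δ≡⊥ : ∀ {w} → Accepts A w → δ ⊥ w ≡ ⊥
  accepts⇒δ≡⊥ (_ , _ , _ , refl , _ , refl , run) = sym (run⇒≡δ run)

  δ≡⊥⇒accepts : ∀ {w} → δ ⊥ w ≡ ⊥ → Accepts A w
  δ≡⊥⇒accepts {w} δw≡⊥ =
    ⊥ , ⊥ , ⊆-min B , refl , ⊆-min B , refl , subst (Run A ⊥ w) δw≡⊥ (run-δ w (⊆-min B))

  isCompleteDeterministic : IsCompleteDeterministic A
  isCompleteDeterministic =
    (⊥ , ⊆-min B , refl) ,
    (λ _ _ _ i≡⊥ _ j≡⊥ → trans i≡⊥ (sym j≡⊥)) ,
    (λ p x _ → step p x , step-⊆ p x , refl) ,
    (λ _ _ _ _ _ _ _ q≡ q′≡ → trans q≡ (sym q′≡))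

  recognizes : Recognizes A (InRepL ϑ B)
  recognizes w =
    (λ acc → δ≡⊥⇒InRepL (accepts⇒δ≡⊥ acc)) ,
    (λ w∈L → δ≡⊥⇒accepts (InRepL⇒δ≡⊥ w∈L))

proposition2 : (n : ℕ) (ϑ : CommRel n) (B : Subset n) →
    IsCompleteDeterministic A[ ϑ , B ] × Recognizes A[ ϑ , B ] (InRepL ϑ B)
proposition2 n ϑ B = isCompleteDeterministic , recognizes
  where open Automaton-A ϑ B
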